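{- The shuffle-group $1+X\mathbb K[[X]]$ is isomorphic to an infinite-dimensional $\mathbb F_p$-vector-space if $\mathbb K$ is a field of positive characteristic $p$.
   Context: For a commutative field $\mathbb K$, the shuffle product on $\mathbb K[[X]]$ is $A\sqcup\!\sqcup B=\sum_{n,m\geq 0}\binom{n+m}{n}\alpha_n\beta_mX^{n+m}$ for $A=\sum_n\alpha_nX^n$, $B=\sum_n\beta_nX^n$; it is associative, commutative and bilinear. The shuffle-group is the group of units of $(\mathbb K[[X]],\sqcup\!\sqcup)$, i.e. the set $\mathbb K^*+X\mathbb K[[X]]$ with the shuffle product; $1+X\mathbb K[[X]]$ is a subgroup of it. -}

module Defs where

open import Level using (Level; _⊔_)
open import Data.Nat as ℕ using (ℕ; zero; suc; _≤_; _∸_)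
open import Data.Nat.Combinatorics using (_C_)
open import Data.Fin using (Fin)
import Data.Fin as Fin
open import Data.Integer as ℤ using (ℤ; +_; 0ℤ; 1ℤ)
import Data.Integer.Properties as ℤP
open import Data.Integer.Divisibility.Signed as Div using (divides)
open import Data.Integer.Tactic.RingSolver using (solve-∀)
open import Function using (_$_)
open import Data.Product using (Σ; _×_; _,_; proj₁; proj₂)
open import Relation.Nullary using (¬_)
open import Relation.Binary.PropositionalEquality as ≡ using (_≡_)
open import Relation.Binary.Structures using (IsEquivalence)
open import Algebra.Bundles using (CommutativeRing; Ring)
open import Algebra.Structures using (IsCommutativeRing)
open import Algebra.Module.Bundles using (LeftModule)

-- The ring ℤ/pℤ (= 𝔽_p when p is prime): carrier ℤ, equality = congruence mod p

module ZMod (p : ℕ) where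

  record _≈ₚ_ (x y : ℤ) : Set where
    constructor mod
    field p∣x-y : (+ p) Div.∣ (x ℤ.- y)

  private
    lem-refl : ∀ x → x ℤ.- x ≡ 0ℤ
    lem-refl x = ℤP.+-inverseʳ x

    ≡⇒≈ : ∀ {x y} → x ≡ y → x ≈ₚ y
    ≡⇒≈ {x} ≡.refl = mod (divides 0ℤ (lem-refl x))

    ≈-sym : ∀ {x y} → x ≈ₚ y → y ≈ₚ x
    ≈-sym {x} {y} (mod d) = mod $ ≡.subst ((+ p) Div.∣_) (lemma x y) (Div.∣m⇒∣-m d)
      where
      lemma : ∀ x y → ℤ.- (x ℤ.- y) ≡ y ℤ.- x
      lemma = solve-∀

    ≈-trans : ∀ {x y z} → x ≈ₚ y → y ≈ₚ z → x ≈ₚ z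
    ≈-trans {x} {y} {z} (mod d) (mod e) = mod $ ≡.subst ((+ p) Div.∣_) (lemma x y z) (Div.∣m∣n⇒∣m+n d e)
      where
      lemma : ∀ x y z → (x ℤ.- y) ℤ.+ (y ℤ.- z) ≡ x ℤ.- z
      lemma = solve-∀

    +-cong : ∀ {x x' y y'} → x ≈ₚ x' → y ≈ₚ y' → (x ℤ.+ y) ≈ₚ (x' ℤ.+ y')
    +-cong {x} {x'} {y} {y'} (mod d) (mod e) = mod $
      ≡.subst ((+ p) Div.∣_) (lemma x x' y y') (Div.∣m∣n⇒∣m+n d e)
      where
      lemma : ∀ x x' y y' → (x ℤ.- x') ℤ.+ (y ℤ.- y') ≡ (x ℤ.+ y) ℤ.- (x' ℤ.+ y')
      lemma = solve-∀

    *-cong : ∀ {x x' y y'} → x ≈ₚ x' → y ≈ₚ y' → (x ℤ.* y) ≈ₚ (x' ℤ.* y')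
    *-cong {x} {x'} {y} {y'} (mod d) (mod e) = mod $
      ≡.subst ((+ p) Div.∣_) (lemma x x' y y')
        (Div.∣m∣n⇒∣m+n (Div.∣n⇒∣m*n x e) (Div.∣m⇒∣m*n y' d))
      where
      lemma : ∀ x x' y y' → x ℤ.* (y ℤ.- y') ℤ.+ (x ℤ.- x') ℤ.* y' ≡ x ℤ.* y ℤ.- x' ℤ.* y'
      lemma = solve-∀

    neg-cong : ∀ {x x'} → x ≈ₚ x' → (ℤ.- x) ≈ₚ (ℤ.- x')
    neg-cong {x} {x'} (mod d) = mod $ ≡.subst ((+ p) Div.∣_) (lemma x x') (Div.∣m⇒∣-m d)
      where
      lemma : ∀ x x' → ℤ.- (x ℤ.- x') ≡ (ℤ.- x) ℤ.- (ℤ.- x')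
      lemma = solve-∀

    isEquiv : IsEquivalence _≈ₚ_
    isEquiv = record { refl = ≡⇒≈ ≡.refl ; sym = ≈-sym ; trans = ≈-trans }

    isCR : IsCommutativeRing _≈ₚ_ ℤ._+_ ℤ._*_ ℤ.-_ 0ℤ 1ℤ
    isCR = record
      { isRing = record
        { +-isAbelianGroup = record
          { isGroup = record
            { isMonoid = record
              { isSemigroup = record
                { isMagma = record { isEquivalence = isEquiv ; ∙-cong = +-cong }
                ; assoc = λ x y z → ≡⇒≈ (ℤP.+-assoc x y z) }
              ; identity = (λ x → ≡⇒≈ (ℤP.+-identityˡ x)) , (λ x → ≡⇒≈ (ℤP.+-identityʳ x)) }
            ; inverse = (λ x → ≡⇒≈ (ℤP.+-inverseˡ x)) , (λ x → ≡⇒≈ (ℤP.+-inverseʳ x))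
            ; ⁻¹-cong = neg-cong }
          ; comm = λ x y → ≡⇒≈ (ℤP.+-comm x y) }
        ; *-cong = *-cong
        ; *-assoc = λ x y z → ≡⇒≈ (ℤP.*-assoc x y z)
        ; *-identity = (λ x → ≡⇒≈ (ℤP.*-identityˡ x)) , (λ x → ≡⇒≈ (ℤP.*-identityʳ x))
        ; distrib = (λ x y z → ≡⇒≈ (ℤP.*-distribˡ-+ x y z)) , (λ x y z → ≡⇒≈ (ℤP.*-distribʳ-+ x y z)) }
      ; *-comm = λ x y → ≡⇒≈ (ℤP.*-comm x y) }

  ℤ/ℤ : CommutativeRing Level.zero Level.zero
  ℤ/ℤ = record { isCommutativeRing = isCR }

  ℤ/ℤ-ring : Ring Level.zero Level.zero
  ℤ/ℤ-ring = CommutativeRing.ring ℤ/ℤ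

module _ {c ℓ : Level} (K : CommutativeRing c ℓ) where
  open CommutativeRing K hiding (zero)

  _·_ : ℕ → Carrier → Carrier
  zero  · x = 0#
  suc n · x = x + (n · x)

  record IsField : Set (c ⊔ ℓ) where
    field
      0≉1     : ¬ (0# ≈ 1#)
      inverse : ∀ x → ¬ (x ≈ 0#) → Σ Carrier (λ y → (x * y) ≈ 1#)

  record HasPositiveCharacteristic (p : ℕ) : Set ℓ where
    field
      positive : 1 ≤ p
      p·1≈0    : (p · 1#) ≈ 0#
      minimal  : ∀ n → 1 ≤ n → (n · 1#) ≈ 0# → p ≤ n

  PowerSeries : Set c
  PowerSeries = ℕ → Carrier

  sumTo : (ℕ → Carrier) → ℕ → Carrier
  sumTo f zero    = f zero
  sumTo f (suc n) = sumTo f n + f (suc n)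

  _⧢_ : PowerSeries → PowerSeries → PowerSeries
  (A ⧢ B) N = sumTo (λ n → (N C n) · (A n * B (N ∸ n))) N

  ShuffleGroup₁ : Set (c ⊔ ℓ)
  ShuffleGroup₁ = Σ PowerSeries (λ A → A zero ≈ 1#)

  _≈ₛ_ : ShuffleGroup₁ → ShuffleGroup₁ → Set ℓ
  A ≈ₛ B = ∀ n → proj₁ A n ≈ proj₁ B n

  -- the group law (closure: the constant coefficient of A ⧢ B is α₀β₀)
  _⧢₁_ : ShuffleGroup₁ → ShuffleGroup₁ → ShuffleGroup₁
  (A , a0) ⧢₁ (B , b0) = (A ⧢ B) ,
    trans (+-identityʳ _) (trans (*-cong a0 b0) (*-identityˡ 1#))

module _ {p : ℕ} {m ℓm : Level} (V : LeftModule (ZMod.ℤ/ℤ-ring p) m ℓm) where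
  open LeftModule V

  linComb : (n : ℕ) → (Fin n → ℤ) → (Fin n → Carrierᴹ) → Carrierᴹ
  linComb zero    c v = 0ᴹ
  linComb (suc n) c v = (c Fin.zero *ₗ v Fin.zero) +ᴹ linComb n (λ i → c (Fin.suc i)) (λ i → v (Fin.suc i))

  LinearlyIndependent : (n : ℕ) → (Fin n → Carrierᴹ) → Set ℓm
  LinearlyIndependent n v =
    ∀ (c : Fin n → ℤ) → linComb n c v ≈ᴹ 0ᴹ → ∀ i → ZMod._≈ₚ_ p (c i) 0ℤ

  InfiniteDimensional : Set (m ⊔ ℓm)
  InfiniteDimensional = ∀ n → Σ (Fin n → Carrierᴹ) (LinearlyIndependent n)

record ShuffleGroupIso {c ℓ : Level} (K : CommutativeRing c ℓ) {p : ℕ} {m ℓm : Level}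
                       (V : LeftModule (ZMod.ℤ/ℤ-ring p) m ℓm) : Set (c ⊔ ℓ ⊔ m ⊔ ℓm) where
  open LeftModule V
  field
    φ           : ShuffleGroup₁ K → Carrierᴹ
    φ-cong      : ∀ A B → _≈ₛ_ K A B → φ A ≈ᴹ φ B
    φ-injective : ∀ A B → φ A ≈ᴹ φ B → _≈ₛ_ K A B
    φ-surjective : ∀ v → Σ (ShuffleGroup₁ K) (λ A → φ A ≈ᴹ v)
    φ-hom       : ∀ A B → φ (_⧢₁_ K A B) ≈ᴹ (φ A +ᴹ φ B)

-- Write D A for the shifted sequence n ↦ A (n + 1). In the basis X^n / n! the shuffle
-- product is the ordinary product of exponential generating functions, so D is a derivation
-- of ⧢ (Leibniz rule). Hence D (A^⧢(n+1)) = (n + 1) · A^⧢n ⧢ D A, which vanishes for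
-- n + 1 = p; so every A with constant term 1 satisfies A^⧢p = 1, and the abelian group
-- 1 + X K[[X]] of exponent p is a ℤ/pℤ-module, with i acting as A ↦ A^⧢(i mod p).
-- On series ≡ 1 (mod X^(m+1)) the coefficient of X^(m+1) is additive for ⧢. In a combination
-- of the elements 1 + X^(s+1), 1 + X^(s+2), … equal to 1 the coefficient of X^(s+1) is
-- therefore (i mod p) · 1 for the first scalar i, which forces i ≡ 0 (mod p) because p is the
-- characteristic; by induction these elements are linearly independent.

module Submission where

open import Level using (_⊔_)
open import Data.Nat as ℕ using (ℕ; zero; suc; _∸_; z≤n; z<s; s≤s; NonZero)
import Data.Nat.Properties as ℕ
open import Data.Nat.Combinatorics using (nCk+nC[k+1]≡[n+1]C[k+1]; k>n⇒nCk≡0)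
  renaming (_C_ to _choose_)
open import Data.Integer as ℤ using (ℤ; +_; -[1+_]; 0ℤ)
import Data.Integer.Properties as ℤ
open import Data.Integer.DivMod using (_%ℕ_; _/ℕ_; a≡a%ℕn+[a/ℕn]*n; n%ℕd<d)
open import Data.Integer.Divisibility.Signed using (divides)
open import Data.Integer.Tactic.RingSolver using (solve-∀)
open import Data.Fin as Fin using (Fin)
open import Data.Product using (Σ; _,_; proj₁; proj₂)
open import Relation.Nullary using (yes; no; contradiction)
open import Relation.Binary.PropositionalEquality as ≡ using (_≡_)
import Relation.Binary.Reasoning.Setoid as SetoidReasoning
open import Algebra.Bundles using (CommutativeMonoid; CommutativeRing)
open import Algebra.Module.Bundles using (LeftModule)
open import Defs hiding (_⧢_; _⧢₁_)
import Defs

m-n≡k*p⇒m≡n+k*p : ∀ m n k p → + m ℤ.- + n ≡ + k ℤ.* + p → m ≡ n ℕ.+ k ℕ.* p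
m-n≡k*p⇒m≡n+k*p m n k p e = ℤ.+-injective (begin
  + m                   ≡⟨ split (+ m) (+ n) ⟩
  + n ℤ.+ (+ m ℤ.- + n) ≡⟨ ≡.cong (λ t → + n ℤ.+ t) e ⟩
  + n ℤ.+ + k ℤ.* + p   ≡⟨ ≡.cong (λ t → + n ℤ.+ t) (ℤ.pos-* k p) ⟨
  + n ℤ.+ + (k ℕ.* p)   ≡⟨ ℤ.pos-+ n (k ℕ.* p) ⟨
  + (n ℕ.+ k ℕ.* p)     ∎)
  where
  open ≡.≡-Reasoning
  split : ∀ a b → a ≡ b ℤ.+ (a ℤ.- b)
  split = solve-∀

m-n≡-k*p⇒n-m≡k*p : ∀ m n k p → + m ℤ.- + n ≡ ℤ.- (+ k) ℤ.* + p → + n ℤ.- + m ≡ + k ℤ.* + p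
m-n≡-k*p⇒n-m≡k*p m n k p e = ≡.trans (negate (+ m) (+ n)) (≡.trans (≡.cong ℤ.-_ e) (negate² (+ k) (+ p)))
  where
  negate : ∀ a b → b ℤ.- a ≡ ℤ.- (a ℤ.- b)
  negate = solve-∀
  negate² : ∀ a b → ℤ.- ((ℤ.- a) ℤ.* b) ≡ a ℤ.* b
  negate² = solve-∀

module _ (p : ℕ) .{{_ : NonZero p}} where
  open ZMod p
  private module ℤ/p = CommutativeRing ℤ/ℤ

  residue : ℤ → ℕ
  residue i = i %ℕ p

  residue-≈ₚ : ∀ i → (+ residue i) ≈ₚ i
  residue-≈ₚ i = mod (divides (ℤ.- (i /ℕ p))
    (≡.subst (λ j → + residue i ℤ.- j ≡ (ℤ.- (i /ℕ p)) ℤ.* + p)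
      (≡.sym (a≡a%ℕn+[a/ℕn]*n i p)) (cancel (+ residue i) (i /ℕ p) (+ p))))
    where
    cancel : ∀ r q d → r ℤ.- (r ℤ.+ q ℤ.* d) ≡ (ℤ.- q) ℤ.* d
    cancel = solve-∀

  +-≈ₚ-residues : ∀ i j → (i ℤ.+ j) ≈ₚ (+ (residue i ℕ.+ residue j))
  +-≈ₚ-residues i j = ℤ/p.trans (ℤ/p.+-cong (ℤ/p.sym (residue-≈ₚ i)) (ℤ/p.sym (residue-≈ₚ j)))
                                (ℤ/p.reflexive (≡.sym (ℤ.pos-+ (residue i) (residue j))))

  *-≈ₚ-residues : ∀ i j → (i ℤ.* j) ≈ₚ (+ (residue i ℕ.* residue j))
  *-≈ₚ-residues i j = ℤ/p.trans (ℤ/p.*-cong (ℤ/p.sym (residue-≈ₚ i)) (ℤ/p.sym (residue-≈ₚ j)))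
                                (ℤ/p.reflexive (≡.sym (ℤ.pos-* (residue i) (residue j))))

module _ {a ℓ} (M : CommutativeMonoid a ℓ) (p : ℕ) .{{_ : NonZero p}} where
  open CommutativeMonoid M
  open import Algebra.Properties.CommutativeMonoid.Mult M
  open SetoidReasoning setoid
  open ZMod p
  private module ℤ/p = CommutativeRing ℤ/ℤ

  ×-ε : ∀ n → n × ε ≈ ε
  ×-ε zero    = refl
  ×-ε (suc n) = trans (identityˡ (n × ε)) (×-ε n)

  module _ (p×x≈ε : ∀ x → p × x ≈ ε) where

    ×-periodic : ∀ n k x → (n ℕ.+ k ℕ.* p) × x ≈ n × x
    ×-periodic n k x = begin
      (n ℕ.+ k ℕ.* p) × x   ≈⟨ ×-homo-+ x n (k ℕ.* p) ⟩
      n × x ∙ (k ℕ.* p) × x ≈⟨ ∙-congˡ (×-assocˡ x k p) ⟨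
      n × x ∙ k × (p × x)   ≈⟨ ∙-congˡ (trans (×-congʳ k (p×x≈ε x)) (×-ε k)) ⟩
      n × x ∙ ε             ≈⟨ identityʳ (n × x) ⟩
      n × x                 ∎

    ×-≈ₚ : ∀ {m n} x → (+ m) ≈ₚ (+ n) → m × x ≈ n × x
    ×-≈ₚ {m} {n} x (mod (divides (+ k) m-n≡kp)) =
      trans (×-congˡ (m-n≡k*p⇒m≡n+k*p m n k p m-n≡kp)) (×-periodic n k x)
    ×-≈ₚ {m} {n} x (mod (divides -[1+ k ] m-n≡-kp)) = sym (trans
      (×-congˡ (m-n≡k*p⇒m≡n+k*p n m (suc k) p (m-n≡-k*p⇒n-m≡k*p m n (suc k) p m-n≡-kp)))
      (×-periodic m (suc k) x))

    residue-× : ∀ {i n} x → i ≈ₚ (+ n) → residue p i × x ≈ n × x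
    residue-× {i} x i≈n = ×-≈ₚ x (ℤ/p.trans (residue-≈ₚ p i) i≈n)

    exponent⇒leftModule : LeftModule ℤ/ℤ-ring a ℓ
    exponent⇒leftModule = record
      { Carrierᴹ = Carrier
      ; _≈ᴹ_ = _≈_
      ; _+ᴹ_ = _∙_
      ; _*ₗ_ = λ i x → residue p i × x
      ; 0ᴹ = ε
      ; -ᴹ_ = ℕ.pred p ×_
      ; isLeftModule = record
        { isLeftSemimodule = record
          { +ᴹ-isCommutativeMonoid = isCommutativeMonoid
          ; isPreleftSemimodule = record
            { *ₗ-cong = λ {i} {j} {x} {y} i≈j x≈y →
                trans (residue-× x (ℤ/p.trans i≈j (ℤ/p.sym (residue-≈ₚ p j)))) (×-congʳ (residue p j) x≈y)
            ; *ₗ-zeroˡ = λ x → residue-× x ℤ/p.refl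
            ; *ₗ-distribʳ = λ x i j →
                trans (residue-× x (+-≈ₚ-residues p i j)) (×-homo-+ x (residue p i) (residue p j))
            ; *ₗ-identityˡ = λ x → trans (residue-× x ℤ/p.refl) (×-homo-1 x)
            ; *ₗ-assoc = λ i j x →
                trans (residue-× x (*-≈ₚ-residues p i j)) (sym (×-assocˡ x (residue p i) (residue p j)))
            ; *ₗ-zeroʳ = λ i → ×-ε (residue p i)
            ; *ₗ-distribˡ = λ i x y → ×-distrib-+ x y (residue p i)
            }
          }
        ; -ᴹ‿cong = ×-congʳ (ℕ.pred p)
        ; -ᴹ‿inverse = (λ x → trans (comm _ x) (inverse x)) , inverse
        }
      }
      where
      inverse : ∀ x → x ∙ ℕ.pred p × x ≈ ε
      inverse x = trans (×-congˡ (ℕ.suc-pred p)) (p×x≈ε x)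

module ShuffleAlgebra {c ℓ} (K : CommutativeRing c ℓ) where
  open CommutativeRing K hiding (zero)
  open import Algebra.Properties.Semiring.Mult semiring using (_×_; ×-congʳ; ×-homo-+; ×-assoc-*)
  open import Algebra.Properties.CommutativeSemigroup +-commutativeSemigroup using (interchange; x∙yz≈y∙xz)
  open SetoidReasoning setoid

  infix 4 _≐_
  infixl 6 _⊕_

  _≐_ : PowerSeries K → PowerSeries K → Set ℓ
  A ≐ B = ∀ n → A n ≈ B n

  _⊕_ : PowerSeries K → PowerSeries K → PowerSeries K
  (A ⊕ B) n = A n + B n

  _×ₛ_ : ℕ → PowerSeries K → PowerSeries K
  (m ×ₛ A) n = m × A n

  𝟘 𝟙 : PowerSeries K
  𝟘 n       = 0#
  𝟙 zero    = 1#
  𝟙 (suc n) = 0#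

  infixl 7 _⧢_

  _⧢_ : PowerSeries K → PowerSeries K → PowerSeries K
  _⧢_ = Defs._⧢_ K

  D : PowerSeries K → PowerSeries K
  D A n = A (suc n)

  ·≡× : ∀ n x → _·_ K n x ≡ n × x
  ·≡× zero    x = ≡.refl
  ·≡× (suc n) x = ≡.cong (λ y → x + y) (·≡× n x)

  sumTo-cong : ∀ {f g} → (∀ k → f k ≈ g k) → ∀ n → sumTo K f n ≈ sumTo K g n
  sumTo-cong f≈g zero    = f≈g zero
  sumTo-cong f≈g (suc n) = +-cong (sumTo-cong f≈g n) (f≈g (suc n))

  sumTo-+ : ∀ f g n → sumTo K (λ k → f k + g k) n ≈ sumTo K f n + sumTo K g n
  sumTo-+ f g zero    = refl
  sumTo-+ f g (suc n) = trans (+-congʳ (sumTo-+ f g n)) (interchange _ _ _ _)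

  sumTo-suc : ∀ f n → sumTo K f (suc n) ≈ f zero + sumTo K (λ k → f (suc k)) n
  sumTo-suc f zero    = refl
  sumTo-suc f (suc n) = trans (+-congʳ (sumTo-suc f n)) (+-assoc _ _ _)

  binomialTerm : ℕ → PowerSeries K → PowerSeries K → ℕ → Carrier
  binomialTerm N A B n = (N choose n) × (A n * B (N ∸ n))

  ⧢≈sumTo : ∀ A B N → (A ⧢ B) N ≈ sumTo K (binomialTerm N A B) N
  ⧢≈sumTo A B N = sumTo-cong (λ n → reflexive (·≡× (N choose n) _)) N

  choose-×-cong : ∀ N j {x y} → (j ℕ.≤ N → x ≈ y) → (N choose j) × x ≈ (N choose j) × y
  choose-×-cong N j x≈y with j ℕ.≤? N
  ... | yes j≤N = ×-congʳ (N choose j) (x≈y j≤N)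
  ... | no  j≰N rewrite k>n⇒nCk≡0 (ℕ.≰⇒> j≰N) = refl

  binomialTerm-pascal : ∀ N A B k → binomialTerm (suc N) A B (suc k)
                       ≈ binomialTerm N (D A) B k + binomialTerm N A (D B) (suc k)
  binomialTerm-pascal N A B k = begin
    (suc N choose suc k) × x                 ≡⟨ ≡.cong (_× x) (nCk+nC[k+1]≡[n+1]C[k+1] N k) ⟨
    (N choose k ℕ.+ N choose suc k) × x      ≈⟨ ×-homo-+ x (N choose k) (N choose suc k) ⟩
    (N choose k) × x + (N choose suc k) × x  ≈⟨ +-congˡ (choose-×-cong N (suc k) (λ k<N →
                                                 *-congˡ (reflexive (≡.cong B (ℕ.+-∸-assoc 1 k<N))))) ⟩
    binomialTerm N (D A) B k + binomialTerm N A (D B) (suc k) ∎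
    where x = A (suc k) * B (N ∸ k)

  ⧢-leibniz : ∀ A B N → (A ⧢ B) (suc N) ≈ (D A ⧢ B) N + (A ⧢ D B) N
  ⧢-leibniz A B N = begin
    (A ⧢ B) (suc N)
      ≈⟨ ⧢≈sumTo A B (suc N) ⟩
    sumTo K (binomialTerm (suc N) A B) (suc N)
      ≈⟨ sumTo-suc _ N ⟩
    t₀ + sumTo K (λ k → binomialTerm (suc N) A B (suc k)) N
      ≈⟨ +-congˡ (trans (sumTo-cong (binomialTerm-pascal N A B) N) (sumTo-+ _ _ N)) ⟩
    t₀ + (sumTo K (binomialTerm N (D A) B) N + sumTo K (λ k → binomialTerm N A (D B) (suc k)) N)
      ≈⟨ x∙yz≈y∙xz _ _ _ ⟩
    sumTo K (binomialTerm N (D A) B) N + (t₀ + sumTo K (λ k → binomialTerm N A (D B) (suc k)) N)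
      ≈⟨ +-congˡ (sym (sumTo-suc _ N)) ⟩
    sumTo K (binomialTerm N (D A) B) N + sumTo K (binomialTerm N A (D B)) (suc N)
      ≈⟨ +-congˡ (trans (+-congˡ lastTerm≈0) (+-identityʳ _)) ⟩
    sumTo K (binomialTerm N (D A) B) N + sumTo K (binomialTerm N A (D B)) N
      ≈⟨ +-cong (⧢≈sumTo (D A) B N) (⧢≈sumTo A (D B) N) ⟨
    (D A ⧢ B) N + (A ⧢ D B) N ∎
    where
    t₀ = binomialTerm (suc N) A B zero
    lastTerm≈0 : binomialTerm N A (D B) (suc N) ≈ 0#
    lastTerm≈0 rewrite k>n⇒nCk≡0 (ℕ.n<1+n N) = refl

  ⧢-constant : ∀ A B → (A ⧢ B) zero ≈ A zero * B zero
  ⧢-constant A B = +-identityʳ _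

  ⧢-cong : ∀ {A A′ B B′} → A ≐ A′ → B ≐ B′ → A ⧢ B ≐ A′ ⧢ B′
  ⧢-cong {A} {A′} {B} {B′} A≐A′ B≐B′ zero = begin
    (A ⧢ B) zero     ≈⟨ ⧢-constant A B ⟩
    A zero * B zero   ≈⟨ *-cong (A≐A′ zero) (B≐B′ zero) ⟩
    A′ zero * B′ zero ≈⟨ ⧢-constant A′ B′ ⟨
    (A′ ⧢ B′) zero   ∎
  ⧢-cong {A} {A′} {B} {B′} A≐A′ B≐B′ (suc n) = begin
    (A ⧢ B) (suc n)                 ≈⟨ ⧢-leibniz A B n ⟩
    (D A ⧢ B) n + (A ⧢ D B) n       ≈⟨ +-cong (⧢-cong (λ k → A≐A′ (suc k)) B≐B′ n)
                                              (⧢-cong A≐A′ (λ k → B≐B′ (suc k)) n) ⟩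
    (D A′ ⧢ B′) n + (A′ ⧢ D B′) n   ≈⟨ ⧢-leibniz A′ B′ n ⟨
    (A′ ⧢ B′) (suc n)               ∎

  ⧢-congˡ : ∀ {A B B′} → B ≐ B′ → A ⧢ B ≐ A ⧢ B′
  ⧢-congˡ {A} = ⧢-cong {A} {A} (λ _ → refl)

  ⧢-congʳ : ∀ {A A′ B} → A ≐ A′ → A ⧢ B ≐ A′ ⧢ B
  ⧢-congʳ {B = B} A≐A′ = ⧢-cong {B = B} {B} A≐A′ (λ _ → refl)

  ⧢-comm : ∀ A B → A ⧢ B ≐ B ⧢ A
  ⧢-comm A B zero = begin
    (A ⧢ B) zero    ≈⟨ ⧢-constant A B ⟩
    A zero * B zero ≈⟨ *-comm (A zero) (B zero) ⟩
    B zero * A zero ≈⟨ ⧢-constant B A ⟨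
    (B ⧢ A) zero    ∎
  ⧢-comm A B (suc n) = begin
    (A ⧢ B) (suc n)           ≈⟨ ⧢-leibniz A B n ⟩
    (D A ⧢ B) n + (A ⧢ D B) n ≈⟨ +-cong (⧢-comm (D A) B n) (⧢-comm A (D B) n) ⟩
    (B ⧢ D A) n + (D B ⧢ A) n ≈⟨ +-comm _ _ ⟩
    (D B ⧢ A) n + (B ⧢ D A) n ≈⟨ ⧢-leibniz B A n ⟨
    (B ⧢ A) (suc n)           ∎

  ⧢-distribʳ : ∀ B A A′ → (A ⊕ A′) ⧢ B ≐ A ⧢ B ⊕ A′ ⧢ B
  ⧢-distribʳ B A A′ zero = begin
    ((A ⊕ A′) ⧢ B) zero                  ≈⟨ ⧢-constant (A ⊕ A′) B ⟩
    (A zero + A′ zero) * B zero          ≈⟨ distribʳ (B zero) (A zero) (A′ zero) ⟩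
    A zero * B zero + A′ zero * B zero   ≈⟨ +-cong (⧢-constant A B) (⧢-constant A′ B) ⟨
    (A ⧢ B) zero + (A′ ⧢ B) zero         ∎
  ⧢-distribʳ B A A′ (suc n) = begin
    ((A ⊕ A′) ⧢ B) (suc n)
      ≈⟨ ⧢-leibniz (A ⊕ A′) B n ⟩
    ((D A ⊕ D A′) ⧢ B) n + ((A ⊕ A′) ⧢ D B) n
      ≈⟨ +-cong (⧢-distribʳ B (D A) (D A′) n) (⧢-distribʳ (D B) A A′ n) ⟩
    ((D A ⧢ B) n + (D A′ ⧢ B) n) + ((A ⧢ D B) n + (A′ ⧢ D B) n)
      ≈⟨ interchange _ _ _ _ ⟩
    ((D A ⧢ B) n + (A ⧢ D B) n) + ((D A′ ⧢ B) n + (A′ ⧢ D B) n)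
      ≈⟨ +-cong (⧢-leibniz A B n) (⧢-leibniz A′ B n) ⟨
    (A ⧢ B) (suc n) + (A′ ⧢ B) (suc n) ∎

  ⧢-distribˡ : ∀ A B B′ → A ⧢ (B ⊕ B′) ≐ A ⧢ B ⊕ A ⧢ B′
  ⧢-distribˡ A B B′ n = begin
    (A ⧢ (B ⊕ B′)) n          ≈⟨ ⧢-comm A (B ⊕ B′) n ⟩
    ((B ⊕ B′) ⧢ A) n          ≈⟨ ⧢-distribʳ A B B′ n ⟩
    (B ⧢ A) n + (B′ ⧢ A) n    ≈⟨ +-cong (⧢-comm B A n) (⧢-comm B′ A n) ⟩
    (A ⧢ B) n + (A ⧢ B′) n    ∎

  ⧢-zeroˡ : ∀ B → 𝟘 ⧢ B ≐ 𝟘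
  ⧢-zeroˡ B zero    = trans (⧢-constant 𝟘 B) (zeroˡ (B zero))
  ⧢-zeroˡ B (suc n) = trans (⧢-leibniz 𝟘 B n) (trans (+-cong (⧢-zeroˡ B n) (⧢-zeroˡ (D B) n)) (+-identityˡ 0#))

  ⧢-zeroʳ : ∀ A → A ⧢ 𝟘 ≐ 𝟘
  ⧢-zeroʳ A n = trans (⧢-comm A 𝟘 n) (⧢-zeroˡ A n)

  ⧢-identityˡ : ∀ B → 𝟙 ⧢ B ≐ B
  ⧢-identityˡ B zero    = trans (⧢-constant 𝟙 B) (*-identityˡ (B zero))
  ⧢-identityˡ B (suc n) = trans (⧢-leibniz 𝟙 B n) (trans (+-cong (⧢-zeroˡ B n) (⧢-identityˡ (D B) n)) (+-identityˡ _))

  ⧢-identityʳ : ∀ A → A ⧢ 𝟙 ≐ A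
  ⧢-identityʳ A n = trans (⧢-comm A 𝟙 n) (⧢-identityˡ A n)

  ⧢-assoc : ∀ A B C → (A ⧢ B) ⧢ C ≐ A ⧢ (B ⧢ C)
  ⧢-assoc A B C zero = begin
    ((A ⧢ B) ⧢ C) zero              ≈⟨ trans (⧢-constant (A ⧢ B) C) (*-congʳ (⧢-constant A B)) ⟩
    (A zero * B zero) * C zero      ≈⟨ *-assoc _ _ _ ⟩
    A zero * (B zero * C zero)      ≈⟨ trans (⧢-constant A (B ⧢ C)) (*-congˡ (⧢-constant B C)) ⟨
    (A ⧢ (B ⧢ C)) zero              ∎
  ⧢-assoc A B C (suc n) = begin
    ((A ⧢ B) ⧢ C) (suc n)
      ≈⟨ ⧢-leibniz (A ⧢ B) C n ⟩
    (D (A ⧢ B) ⧢ C) n + ((A ⧢ B) ⧢ D C) n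
      ≈⟨ +-cong (trans (⧢-congʳ {B = C} (⧢-leibniz A B) n) (⧢-distribʳ C (D A ⧢ B) (A ⧢ D B) n))
                (⧢-assoc A B (D C) n) ⟩
    (((D A ⧢ B) ⧢ C) n + ((A ⧢ D B) ⧢ C) n) + (A ⧢ (B ⧢ D C)) n
      ≈⟨ +-cong (+-cong (⧢-assoc (D A) B C n) (⧢-assoc A (D B) C n)) refl ⟩
    ((D A ⧢ (B ⧢ C)) n + (A ⧢ (D B ⧢ C)) n) + (A ⧢ (B ⧢ D C)) n
      ≈⟨ +-assoc _ _ _ ⟩
    (D A ⧢ (B ⧢ C)) n + ((A ⧢ (D B ⧢ C)) n + (A ⧢ (B ⧢ D C)) n)
      ≈⟨ +-congˡ (⧢-distribˡ A (D B ⧢ C) (B ⧢ D C) n) ⟨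
    (D A ⧢ (B ⧢ C)) n + (A ⧢ (D B ⧢ C ⊕ B ⧢ D C)) n
      ≈⟨ +-congˡ (⧢-congˡ {A} (⧢-leibniz B C) n) ⟨
    (D A ⧢ (B ⧢ C)) n + (A ⧢ D (B ⧢ C)) n
      ≈⟨ ⧢-leibniz A (B ⧢ C) n ⟨
    (A ⧢ (B ⧢ C)) (suc n) ∎

  ⧢-×ₛ : ∀ m A B → A ⧢ (m ×ₛ B) ≐ m ×ₛ (A ⧢ B)
  ⧢-×ₛ zero    A B n = ⧢-zeroʳ A n
  ⧢-×ₛ (suc m) A B n = trans (⧢-distribˡ A B (m ×ₛ B) n) (+-congˡ (⧢-×ₛ m A B n))

  infixr 8 _^_

  _^_ : PowerSeries K → ℕ → PowerSeries K
  A ^ zero  = 𝟙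
  A ^ suc n = A ⧢ A ^ n

  D-^ : ∀ A n → D (A ^ suc n) ≐ suc n ×ₛ (A ^ n ⧢ D A)
  D-^ A zero k = begin
    (A ⧢ 𝟙) (suc k)   ≈⟨ ⧢-identityʳ A (suc k) ⟩
    A (suc k)         ≈⟨ ⧢-identityˡ (D A) k ⟨
    (𝟙 ⧢ D A) k       ≈⟨ +-identityʳ _ ⟨
    (𝟙 ⧢ D A) k + 0#  ∎
  D-^ A (suc n) k = begin
    (A ⧢ P) (suc k)                              ≈⟨ ⧢-leibniz A P k ⟩
    (D A ⧢ P) k + (A ⧢ D P) k                    ≈⟨ +-cong (⧢-comm (D A) P k) (⧢-congˡ {A} (D-^ A n) k) ⟩
    (P ⧢ D A) k + (A ⧢ suc n ×ₛ (A ^ n ⧢ D A)) k ≈⟨ +-congˡ (⧢-×ₛ (suc n) A (A ^ n ⧢ D A) k) ⟩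
    (P ⧢ D A) k + suc n × (A ⧢ (A ^ n ⧢ D A)) k  ≈⟨ +-congˡ (×-congʳ (suc n) (⧢-assoc A (A ^ n) (D A) k)) ⟨
    (P ⧢ D A) k + suc n × (P ⧢ D A) k            ∎
    where P = A ^ suc n

  ^-constant : ∀ {A} n → A zero ≈ 1# → (A ^ n) zero ≈ 1#
  ^-constant zero    A₀≈1 = refl
  ^-constant {A} (suc n) A₀≈1 =
    trans (⧢-constant A (A ^ n)) (trans (*-cong A₀≈1 (^-constant n A₀≈1)) (*-identityˡ 1#))

  ×-characteristic : ∀ p → p × 1# ≈ 0# → ∀ x → p × x ≈ 0#
  ×-characteristic p p×1≈0 x = begin
    p × x         ≈⟨ ×-congʳ p (*-identityˡ x) ⟨
    p × (1# * x)  ≈⟨ ×-assoc-* p 1# x ⟨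
    (p × 1#) * x  ≈⟨ *-congʳ p×1≈0 ⟩
    0# * x        ≈⟨ zeroˡ x ⟩
    0#            ∎

  ^-characteristic : ∀ {A} p → p × 1# ≈ 0# → A zero ≈ 1# → A ^ p ≐ 𝟙
  ^-characteristic zero    p×1≈0 A₀≈1 n       = refl
  ^-characteristic (suc q) p×1≈0 A₀≈1 zero    = ^-constant (suc q) A₀≈1
  ^-characteristic {A} (suc q) p×1≈0 A₀≈1 (suc k) =
    trans (D-^ A q k) (×-characteristic (suc q) p×1≈0 _)

  _⧢₁_ : ShuffleGroup₁ K → ShuffleGroup₁ K → ShuffleGroup₁ K
  _⧢₁_ = Defs._⧢₁_ K

  shuffleMonoid₁ : CommutativeMonoid (c ⊔ ℓ) ℓ
  shuffleMonoid₁ = record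
    { Carrier = ShuffleGroup₁ K
    ; _≈_ = _≈ₛ_ K
    ; _∙_ = _⧢₁_
    ; ε = 𝟙 , refl
    ; isCommutativeMonoid = record
      { isMonoid = record
        { isSemigroup = record
          { isMagma = record
            { isEquivalence = record
              { refl  = λ _ → refl
              ; sym   = λ A≐B n → sym (A≐B n)
              ; trans = λ A≐B B≐C n → trans (A≐B n) (B≐C n)
              }
            ; ∙-cong = ⧢-cong
            }
          ; assoc = λ (A , _) (B , _) (C , _) → ⧢-assoc A B C }
        ; identity = (λ (A , _) → ⧢-identityˡ A) , (λ (A , _) → ⧢-identityʳ A) }
      ; comm = λ (A , _) (B , _) → ⧢-comm A B } }

  open import Algebra.Properties.CommutativeMonoid.Mult shuffleMonoid₁ using () renaming (_×_ to _×₁_)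

  proj₁-×₁ : ∀ n X → proj₁ (n ×₁ X) ≡ proj₁ X ^ n
  proj₁-×₁ zero    X = ≡.refl
  proj₁-×₁ (suc n) X = ≡.cong (proj₁ X ⧢_) (proj₁-×₁ n X)

  VanishesBelow : ℕ → PowerSeries K → Set ℓ
  VanishesBelow m A = ∀ j → j ℕ.< m → A j ≈ 0#

  vanishesBelow-pred : ∀ {m A} → VanishesBelow (suc m) A → VanishesBelow m A
  vanishesBelow-pred A≈0 j j<m = A≈0 j (ℕ.m<n⇒m<1+n j<m)

  vanishesBelow-D : ∀ {m A} → VanishesBelow (suc m) A → VanishesBelow m (D A)
  vanishesBelow-D A≈0 j j<m = A≈0 (suc j) (s≤s j<m)

  ⧢-vanishesBelow : ∀ m {A} B → VanishesBelow m A → VanishesBelow m (A ⧢ B)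
  ⧢-vanishesBelow (suc m) {A} B A≈0 zero _ =
    trans (⧢-constant A B) (trans (*-congʳ (A≈0 zero z<s)) (zeroˡ (B zero)))
  ⧢-vanishesBelow (suc m) {A} B A≈0 (suc j) (s≤s j<m) = begin
    (A ⧢ B) (suc j)            ≈⟨ ⧢-leibniz A B j ⟩
    (D A ⧢ B) j + (A ⧢ D B) j  ≈⟨ +-cong (⧢-vanishesBelow m B (vanishesBelow-D A≈0) j j<m)
                                         (⧢-vanishesBelow m (D B) (vanishesBelow-pred A≈0) j j<m) ⟩
    0# + 0#                    ≈⟨ +-identityʳ 0# ⟩
    0#                         ∎

  ⧢-leading : ∀ m {A} B → VanishesBelow m A → (A ⧢ B) m ≈ A m * B zero
  ⧢-leading zero    {A} B _   = ⧢-constant A B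
  ⧢-leading (suc m) {A} B A≈0 = begin
    (A ⧢ B) (suc m)            ≈⟨ ⧢-leibniz A B m ⟩
    (D A ⧢ B) m + (A ⧢ D B) m  ≈⟨ +-cong (⧢-leading m B (vanishesBelow-D A≈0))
                                         (⧢-vanishesBelow (suc m) (D B) A≈0 m ℕ.≤-refl) ⟩
    A (suc m) * B zero + 0#    ≈⟨ +-identityʳ _ ⟩
    A (suc m) * B zero         ∎

  -- A ≡ 1 (mod X^(m+1))
  record IsOneMod (m : ℕ) (A : PowerSeries K) : Set ℓ where
    constructor _,_
    field
      constant : A zero ≈ 1#
      higher   : VanishesBelow m (D A)

  𝟙-isOneMod : ∀ m → IsOneMod m 𝟙
  𝟙-isOneMod m = refl , λ _ _ → refl

  isOneMod-pred : ∀ {m A} → IsOneMod (suc m) A → IsOneMod m A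
  isOneMod-pred (A₀≈1 , DA≈0) = A₀≈1 , vanishesBelow-pred DA≈0

  isOneMod-next : ∀ {m A} → IsOneMod (suc m) A → A (suc m) ≈ 0#
  isOneMod-next (_ , DA≈0) = DA≈0 _ ℕ.≤-refl

  ⧢-isOneMod : ∀ {m A B} → IsOneMod m A → IsOneMod m B → IsOneMod m (A ⧢ B)
  ⧢-isOneMod {m} {A} {B} (A₀≈1 , DA≈0) (B₀≈1 , DB≈0) =
    trans (⧢-constant A B) (trans (*-cong A₀≈1 B₀≈1) (*-identityˡ 1#)) , λ j j<m → begin
      (A ⧢ B) (suc j)            ≈⟨ ⧢-leibniz A B j ⟩
      (D A ⧢ B) j + (A ⧢ D B) j  ≈⟨ +-cong (⧢-vanishesBelow m B DA≈0 j j<m)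
                                           (trans (⧢-comm A (D B) j) (⧢-vanishesBelow m A DB≈0 j j<m)) ⟩
      0# + 0#                    ≈⟨ +-identityʳ 0# ⟩
      0#                         ∎

  ⧢-next : ∀ {m A B} → IsOneMod m A → IsOneMod m B → (A ⧢ B) (suc m) ≈ A (suc m) + B (suc m)
  ⧢-next {m} {A} {B} (A₀≈1 , DA≈0) (B₀≈1 , DB≈0) = begin
    (A ⧢ B) (suc m)                    ≈⟨ ⧢-leibniz A B m ⟩
    (D A ⧢ B) m + (A ⧢ D B) m          ≈⟨ +-congˡ (⧢-comm A (D B) m) ⟩
    (D A ⧢ B) m + (D B ⧢ A) m          ≈⟨ +-cong (⧢-leading m B DA≈0) (⧢-leading m A DB≈0) ⟩
    A (suc m) * B zero + B (suc m) * A zero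
                                       ≈⟨ +-cong (*-congˡ B₀≈1) (*-congˡ A₀≈1) ⟩
    A (suc m) * 1# + B (suc m) * 1#    ≈⟨ +-cong (*-identityʳ _) (*-identityʳ _) ⟩
    A (suc m) + B (suc m)              ∎

  ^-isOneMod : ∀ {m A} → IsOneMod m A → ∀ n → IsOneMod m (A ^ n)
  ^-isOneMod {m} A≡1 zero    = 𝟙-isOneMod m
  ^-isOneMod     A≡1 (suc n) = ⧢-isOneMod A≡1 (^-isOneMod A≡1 n)

  ^-next : ∀ {m A} → IsOneMod m A → ∀ n → (A ^ n) (suc m) ≈ n × A (suc m)
  ^-next A≡1 zero    = refl
  ^-next A≡1 (suc n) = trans (⧢-next A≡1 (^-isOneMod A≡1 n)) (+-congˡ (^-next A≡1 n))

  ×₁-isOneMod : ∀ {m} X → IsOneMod m (proj₁ X) → ∀ n → IsOneMod m (proj₁ (n ×₁ X))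
  ×₁-isOneMod X X≡1 n rewrite proj₁-×₁ n X = ^-isOneMod X≡1 n

  ×₁-next : ∀ {m} X → IsOneMod m (proj₁ X) → ∀ n → proj₁ (n ×₁ X) (suc m) ≈ n × proj₁ X (suc m)
  ×₁-next X X≡1 n rewrite proj₁-×₁ n X = ^-next X≡1 n

  X^_ : ℕ → PowerSeries K
  (X^ zero)  zero    = 1#
  (X^ zero)  (suc k) = 0#
  (X^ suc s) zero    = 0#
  (X^ suc s) (suc k) = (X^ s) k

  X^-below : ∀ s j → j ℕ.< s → (X^ s) j ≡ 0#
  X^-below (suc s) zero    _         = ≡.refl
  X^-below (suc s) (suc j) (s≤s j<s) = X^-below s j j<s

  X^-diagonal : ∀ s → (X^ s) s ≡ 1#
  X^-diagonal zero    = ≡.refl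
  X^-diagonal (suc s) = X^-diagonal s

  1+X^suc : ℕ → ShuffleGroup₁ K
  1+X^suc s = 𝟙 ⊕ X^ suc s , +-identityʳ 1#

  1+X^suc-isOneMod : ∀ s → IsOneMod s (proj₁ (1+X^suc s))
  1+X^suc-isOneMod s = +-identityʳ 1# , λ j j<s → trans (+-identityˡ _) (reflexive (X^-below s j j<s))

  1+X^suc-next : ∀ s → proj₁ (1+X^suc s) (suc s) ≈ 1#
  1+X^suc-next s = trans (+-identityˡ _) (reflexive (X^-diagonal s))

module ShuffleGroupModule {c ℓ} (K : CommutativeRing c ℓ) {p} (char : HasPositiveCharacteristic K p) where
  open CommutativeRing K hiding (zero)
  open HasPositiveCharacteristic char
  open ShuffleAlgebra K
  open import Algebra.Properties.Semiring.Mult semiring using (_×_; ×-congʳ)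
  open import Algebra.Properties.CommutativeMonoid.Mult shuffleMonoid₁ using () renaming (_×_ to _×₁_)
  open SetoidReasoning setoid
  open ZMod p using (_≈ₚ_)
  private module ℤ/p = CommutativeRing (ZMod.ℤ/ℤ p)

  instance
    p≢0 : NonZero p
    p≢0 = ℕ.>-nonZero positive

  ×₁-characteristic : ∀ X → _≈ₛ_ K (p ×₁ X) (𝟙 , refl)
  ×₁-characteristic X rewrite proj₁-×₁ p X =
    ^-characteristic p (trans (reflexive (≡.sym (·≡× p 1#))) p·1≈0) (proj₂ X)

  shuffleModule : LeftModule (ZMod.ℤ/ℤ-ring p) (c ⊔ ℓ) ℓ
  shuffleModule = exponent⇒leftModule shuffleMonoid₁ p ×₁-characteristic

  ×1≈0⇒≡0 : ∀ n → n ℕ.< p → n × 1# ≈ 0# → n ≡ 0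
  ×1≈0⇒≡0 zero    _   _        = ≡.refl
  ×1≈0⇒≡0 (suc n) n<p n×1≈0 =
    contradiction (minimal (suc n) (s≤s z≤n) (trans (reflexive (·≡× (suc n) 1#)) n×1≈0)) (ℕ.<⇒≱ n<p)

  basis : ∀ s n → Fin n → ShuffleGroup₁ K
  basis s (suc n) Fin.zero    = 1+X^suc s
  basis s (suc n) (Fin.suc i) = basis (suc s) n i

  linComb-isOneMod : ∀ n s c → IsOneMod s (proj₁ (linComb shuffleModule n c (basis s n)))
  linComb-isOneMod zero    s c = 𝟙-isOneMod s
  linComb-isOneMod (suc n) s c =
    ⧢-isOneMod (×₁-isOneMod (1+X^suc s) (1+X^suc-isOneMod s) (residue p (c Fin.zero)))
               (isOneMod-pred (linComb-isOneMod n (suc s) (λ i → c (Fin.suc i))))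

  basis-independent : ∀ n s → LinearlyIndependent shuffleModule n (basis s n)
  basis-independent zero    s c _ ()
  basis-independent (suc n) s c combination≈1 = λ where
      Fin.zero    → c₀≈0
      (Fin.suc i) → basis-independent n (suc s) (λ i → c (Fin.suc i)) tail≈1 i
    where
    r = residue p (c Fin.zero)
    head = r ×₁ 1+X^suc s
    tail = linComb shuffleModule n (λ i → c (Fin.suc i)) (basis (suc s) n)
    tail≡1 = linComb-isOneMod n (suc s) (λ i → c (Fin.suc i))
    head≡1 = ×₁-isOneMod (1+X^suc s) (1+X^suc-isOneMod s) r

    r×1≈0 : r × 1# ≈ 0#
    r×1≈0 = begin
      r × 1#                                   ≈⟨ ×-congʳ r (1+X^suc-next s) ⟨
      r × proj₁ (1+X^suc s) (suc s)            ≈⟨ ×₁-next (1+X^suc s) (1+X^suc-isOneMod s) r ⟨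
      proj₁ head (suc s)                       ≈⟨ +-identityʳ _ ⟨
      proj₁ head (suc s) + 0#                  ≈⟨ +-congˡ (isOneMod-next tail≡1) ⟨
      proj₁ head (suc s) + proj₁ tail (suc s)  ≈⟨ ⧢-next head≡1 (isOneMod-pred tail≡1) ⟨
      proj₁ (head ⧢₁ tail) (suc s)             ≈⟨ combination≈1 (suc s) ⟩
      0#                                       ∎

    r≡0 : r ≡ 0
    r≡0 = ×1≈0⇒≡0 r (n%ℕd<d (c Fin.zero) p) r×1≈0

    c₀≈0 : c Fin.zero ≈ₚ 0ℤ
    c₀≈0 = ≡.subst (λ k → c Fin.zero ≈ₚ (+ k)) r≡0 (ℤ/p.sym (residue-≈ₚ p (c Fin.zero)))

    head≐𝟙 : proj₁ head ≐ 𝟙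
    head≐𝟙 k = reflexive (≡.cong (λ n → proj₁ (n ×₁ 1+X^suc s) k) r≡0)

    tail≈1 : _≈ₛ_ K tail (𝟙 , refl)
    tail≈1 k = begin
      proj₁ tail k                 ≈⟨ ⧢-identityˡ (proj₁ tail) k ⟨
      (𝟙 ⧢ proj₁ tail) k           ≈⟨ ⧢-congʳ {B = proj₁ tail} head≐𝟙 k ⟨
      (proj₁ head ⧢ proj₁ tail) k  ≈⟨ combination≈1 k ⟩
      𝟙 k                          ∎

  shuffleModule-infiniteDimensional : InfiniteDimensional shuffleModule
  shuffleModule-infiniteDimensional n = basis 0 n , basis-independent n 0

  shuffleModule-iso : ShuffleGroupIso K shuffleModule
  shuffleModule-iso = record
    { φ            = λ X → X
    ; φ-cong       = λ _ _ A≈B → A≈B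
    ; φ-injective  = λ _ _ A≈B → A≈B
    ; φ-surjective = λ X → X , λ _ → refl
    ; φ-hom        = λ _ _ _ → refl
    }

-- Imported only here, since above _×_ denotes natural-number multiples.
open import Data.Product using (_×_)

proposition3p3 : ∀ {c ℓ} (K : CommutativeRing c ℓ) → IsField K → (p : ℕ) → HasPositiveCharacteristic K p →
    Σ (LeftModule (ZMod.ℤ/ℤ-ring p) (c ⊔ ℓ) ℓ) (λ V → InfiniteDimensional V × ShuffleGroupIso K V)
proposition3p3 K _ p char = shuffleModule , shuffleModule-infiniteDimensional , shuffleModule-iso
  where open ShuffleGroupModule K char
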